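{- Let $n$ and $k$ be integers with $0\le k\le n-k$. Up to isometry there are exactly $k+1$ spaces in $\mathcal{A}^3_{\infty,0,7,8}$ with $n$ points whose point set is the disjoint union of a $2$-clique $Q_1$ on $k$ points and a $2$-clique $Q_2$ on $n-k$ points. Explicitly, in such a space each point of $Q_1$ is at distance $3$ from either no point or exactly one point of $Q_2$, and is at distance $1$ from every other point of $Q_2$.
   Context: $\mathcal{A}^3_{\infty,0,7,8}$ is the class of finite metric spaces, all of whose distances between distinct points lie in $\{1,2,3\}$, in which for every three distinct points the multiset of their pairwise distances is one of $\{1,1,2\}$, $\{1,2,3\}$, $\{2,2,2\}$. A $2$-clique is a set of points any two distinct members of which are at distance $2$ (it may be empty or a single point). -}

module Defs where

open import Data.Nat using (ℕ; suc; _≤_; _+_)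
open import Data.Fin using (Fin)
open import Data.Fin.Subset using (Subset; _∈_; _∉_; ∁; ∣_∣)
open import Data.List using (List; []; _∷_)
open import Data.List.Relation.Binary.Permutation.Propositional using (_↭_)
open import Data.Product using (Σ; _×_)
open import Data.Sum using (_⊎_)
open import Relation.Binary.PropositionalEquality using (_≡_; _≢_)
open import Function.Bundles using (_↔_; Inverse)

Dist : ℕ → Set
Dist n = Fin n → Fin n → ℕ

record IsMetric {n : ℕ} (d : Dist n) : Set where
  field
    zero-iff : ∀ x y → d x y ≡ 0 → x ≡ y
    refl0    : ∀ x → d x x ≡ 0
    sym      : ∀ x y → d x y ≡ d y x
    triangle : ∀ x y z → d x z ≤ d x y + d y z

In123 : ℕ → Set
In123 a = (a ≡ 1) ⊎ (a ≡ 2) ⊎ (a ≡ 3)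

-- The multiset {a,b,c} is one of {1,1,2}, {1,2,3}, {2,2,2}
-- (multiset equality = permutation of lists).
AllowedTriangle : ℕ → ℕ → ℕ → Set
AllowedTriangle a b c =
  ((a ∷ b ∷ c ∷ []) ↭ (1 ∷ 1 ∷ 2 ∷ []))
  ⊎ ((a ∷ b ∷ c ∷ []) ↭ (1 ∷ 2 ∷ 3 ∷ []))
  ⊎ ((a ∷ b ∷ c ∷ []) ↭ (2 ∷ 2 ∷ 2 ∷ []))

record InA {n : ℕ} (d : Dist n) : Set where
  field
    metric    : IsMetric d
    distances : ∀ x y → x ≢ y → In123 (d x y)
    triangles : ∀ x y z → x ≢ y → y ≢ z → x ≢ z →
                AllowedTriangle (d x y) (d y z) (d x z)

TwoClique : {n : ℕ} → Dist n → Subset n → Set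
TwoClique d Q = ∀ x y → x ∈ Q → y ∈ Q → x ≢ y → d x y ≡ 2

TwoCliqueSplit : {n : ℕ} → Dist n → ℕ → Subset n → Set
TwoCliqueSplit d k Q =
  ∣ Q ∣ ≡ k × TwoClique d Q × TwoClique d (∁ Q)
  × (∀ x y → x ∈ Q → y ∉ Q → d x y ≢ 2)

HasTwoCliqueSplit : {n : ℕ} → Dist n → ℕ → Set
HasTwoCliqueSplit {n} d k = Σ (Subset n) λ Q → TwoCliqueSplit d k Q

Isometric : {n : ℕ} → Dist n → Dist n → Set
Isometric {n} d d' =
  Σ (Fin n ↔ Fin n) λ f → ∀ x y → d' (Inverse.to f x) (Inverse.to f y) ≡ d x y

-- Across the two cliques every distance is 1 or 3, and since no allowed triangle has two
-- sides of length 3, the pairs at distance 3 form a matching between Q₁ and Q₂. Conversely,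
-- two cliques joined in this way always give a space of the class. Removing unmatched
-- points and matched pairs one at a time therefore yields an isometry onto a canonical
-- space made of a matched pairs, k − a unmatched points of Q₁ and n − k − a unmatched
-- points of Q₂, where 0 ≤ a ≤ k. The number 2a of points having a point at distance 3 is
-- an isometry invariant, so the k + 1 canonical spaces are pairwise non-isometric.

module Submission where

open import Defs
open import Data.Bool using (Bool; true; false; not; if_then_else_)
open import Data.Bool.Properties using (¬-not) renaming (_≟_ to _≟ᵇ_)
open import Data.Empty using (⊥; ⊥-elim)
open import Data.Fin using (Fin; zero; suc; toℕ; fromℕ<; punchIn; punchOut)
open import Data.Fin.Permutation as Perm using (Permutation; insert; _⟨$⟩ʳ_; _⟨$⟩ˡ_; inverseʳ)
open import Data.Fin.Properties using (any?; punchIn-injective; punchInᵢ≢i; punchIn-punchOut; toℕ≤pred[n]; toℕ-fromℕ<; toℕ-injective) renaming (_≟_ to _≟ᶠ_)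
open import Data.Fin.Subset using (Subset; _∈_; _∉_; ∣_∣)
open import Data.Fin.Subset.Properties using (x∈∁p⇒x∉p; x∉p⇒x∈∁p)
open import Data.List using ([]; _∷_)
open import Data.List.Relation.Binary.Permutation.Propositional using (_↭_; prep; swap; ↭-refl; ↭-trans)
open import Data.Nat using (ℕ; zero; suc; _+_; _∸_; _≤_; _<_; z≤n; s≤s)
open import Data.Nat.ListAction.Properties using (product-↭)
open import Data.Nat.Properties using (+-0-commutativeMonoid; +-suc; suc-injective; ≤ᵇ⇒≤; ≤-refl; m≤m+n; m≤n+m; ≤-trans; m∸n≤m; m∸n+n≡m; m+n∸n≡m; ∸-+-assoc) renaming (_≟_ to _≟ⁿ_)
open import Data.Nat.Solver using (module +-*-Solver)
open import Algebra.Properties.CommutativeMonoid.Sum +-0-commutativeMonoid using (sum; sum-permute; sum-cong-≗)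
open import Data.Product using (Σ; ∃-syntax; _×_; _,_; proj₁; proj₂; map₂)
open import Data.Sum using (_⊎_; inj₁; inj₂)
open import Data.Vec using ([]; _∷_; lookup; tabulate)
open import Data.Vec.Functional using () renaming (_∷_ to _◂_)
open import Data.Vec.Properties using ([]=⇒lookup; lookup⇒[]=; lookup∘tabulate)
open import Function using (_∘_; flip; _⇔_; mk⇔)
open import Relation.Nullary using (¬_; Dec; yes; no; ¬?; does; contradiction)
open import Relation.Nullary.Decidable using (_×-dec_; dec-true; dec-false; does-⇔; decidable-stable)
open import Relation.Binary.PropositionalEquality

-- Split spaces

record Sided (n : ℕ) : Set where
  constructor ⟨_,_⟩
  field
    dist : Dist n
    side : Fin n → Bool
open Sided

HasPartner : ∀ {n} → Dist n → Fin n → Set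
HasPartner d x = ∃[ y ] d x y ≡ 3

hasPartner? : ∀ {n} (d : Dist n) x → Dec (HasPartner d x)
hasPartner? d x = any? (λ y → d x y ≟ⁿ 3)

-- The side of a point says whether it lies in Q₁.
record SplitSpace {n} (X : Sided n) : Set where
  field
    dist-refl      : ∀ x → dist X x x ≡ 0
    dist-sym       : ∀ x y → dist X x y ≡ dist X y x
    same-side      : ∀ {x y} → x ≢ y → side X x ≡ side X y → dist X x y ≡ 2
    other-side     : ∀ {x y} → side X x ≢ side X y → dist X x y ≡ 1 ⊎ dist X x y ≡ 3
    partner-unique : ∀ {x y z} → dist X x y ≡ 3 → dist X x z ≡ 3 → y ≡ z

sideDist : Bool → Bool → ℕ
sideDist true  true  = 2
sideDist false false = 2
sideDist true  false = 1
sideDist false true  = 1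

sideDist-≡ : ∀ {b c} → b ≡ c → sideDist b c ≡ 2
sideDist-≡ {true}  refl = refl
sideDist-≡ {false} refl = refl

sideDist-≢ : ∀ {b c} → b ≢ c → sideDist b c ≡ 1
sideDist-≢ {true}  {true}  b≢c = contradiction refl b≢c
sideDist-≢ {true}  {false} _   = refl
sideDist-≢ {false} {true}  _   = refl
sideDist-≢ {false} {false} b≢c = contradiction refl b≢c

sideDist≢3 : ∀ b c → sideDist b c ≢ 3
sideDist≢3 true  true  ()
sideDist≢3 true  false ()
sideDist≢3 false true  ()
sideDist≢3 false false ()

module SplitSpaceProperties {n} {X : Sided n} (S : SplitSpace X) where
  open SplitSpace S

  partner-≢ : ∀ {x y} → dist X x y ≡ 3 → x ≢ y
  partner-≢ {x} d≡3 refl = contradiction (trans (sym (dist-refl x)) d≡3) λ ()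

  partner-side : ∀ {x y} → dist X x y ≡ 3 → side X x ≢ side X y
  partner-side d≡3 s≡s = contradiction (trans (sym d≡3) (same-side (partner-≢ d≡3) s≡s)) λ ()

  partner-uniqueˡ : ∀ {x y z} → dist X x z ≡ 3 → dist X y z ≡ 3 → x ≡ y
  partner-uniqueˡ {x} {y} {z} e e′ =
    partner-unique (trans (dist-sym z x) e) (trans (dist-sym z y) e′)

  dist-nonpartner : ∀ {x y} → x ≢ y → dist X x y ≢ 3 → dist X x y ≡ sideDist (side X x) (side X y)
  dist-nonpartner {x} {y} x≢y ≢3 with side X x ≟ᵇ side X y
  ... | yes s≡s = trans (same-side x≢y s≡s) (sym (sideDist-≡ s≡s))
  ... | no s≢s with other-side s≢s
  ...   | inj₁ d≡1 = trans d≡1 (sym (sideDist-≢ s≢s))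
  ...   | inj₂ d≡3 = contradiction d≡3 ≢3

-- One-point extensions and the canonical spaces

extendDist : ∀ {n} → (Fin n → ℕ) → Dist n → Dist (suc n)
extendDist row d zero    zero    = 0
extendDist row d zero    (suc y) = row y
extendDist row d (suc x) zero    = row x
extendDist row d (suc x) (suc y) = d x y

extend : ∀ {n} → Bool → (Fin n → ℕ) → Sided n → Sided (suc n)
extend b row X = ⟨ extendDist row (dist X) , b ◂ side X ⟩

record IsSplitRow {n} (X : Sided n) (b : Bool) (row : Fin n → ℕ) : Set where
  field
    row-same        : ∀ {y} → side X y ≡ b → row y ≡ 2
    row-other       : ∀ {y} → side X y ≢ b → row y ≡ 1 ⊎ row y ≡ 3
    row-unique      : ∀ {y z} → row y ≡ 3 → row z ≡ 3 → y ≡ z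
    row-unpartnered : ∀ {y} → row y ≡ 3 → ¬ HasPartner (dist X) y

extend-splitSpace : ∀ {n} {X : Sided n} {b row} →
  SplitSpace X → IsSplitRow X b row → SplitSpace (extend b row X)
extend-splitSpace {n} {X} {b} {row} S R = record
  { dist-refl      = refl′
  ; dist-sym       = sym′
  ; same-side      = λ {x y} → same′ {x} {y}
  ; other-side     = λ {x y} → other′ {x} {y}
  ; partner-unique = λ {x y z} → unique′ {x} {y} {z}
  }
  where
  open SplitSpace S
  open IsSplitRow R
  X′ : Sided (suc n)
  X′ = extend b row X

  refl′ : ∀ x → dist X′ x x ≡ 0
  refl′ zero    = refl
  refl′ (suc x) = dist-refl x

  sym′ : ∀ x y → dist X′ x y ≡ dist X′ y x
  sym′ zero    zero    = refl
  sym′ zero    (suc y) = refl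
  sym′ (suc x) zero    = refl
  sym′ (suc x) (suc y) = dist-sym x y

  same′ : ∀ {x y} → x ≢ y → side X′ x ≡ side X′ y → dist X′ x y ≡ 2
  same′ {zero}  {zero}  x≢y _   = contradiction refl x≢y
  same′ {zero}  {suc y} _   s≡s = row-same (sym s≡s)
  same′ {suc x} {zero}  _   s≡s = row-same s≡s
  same′ {suc x} {suc y} x≢y s≡s = same-side (x≢y ∘ cong suc) s≡s

  other′ : ∀ {x y} → side X′ x ≢ side X′ y → dist X′ x y ≡ 1 ⊎ dist X′ x y ≡ 3
  other′ {zero}  {zero}  s≢s = contradiction refl s≢s
  other′ {zero}  {suc y} s≢s = row-other (s≢s ∘ sym)
  other′ {suc x} {zero}  s≢s = row-other s≢s
  other′ {suc x} {suc y} s≢s = other-side s≢s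

  unique′ : ∀ {x y z} → dist X′ x y ≡ 3 → dist X′ x z ≡ 3 → y ≡ z
  unique′ {zero}  {zero}              ()
  unique′ {zero}  {suc y} {zero}      _  ()
  unique′ {zero}  {suc y} {suc z}     e  e′ = cong suc (row-unique e e′)
  unique′ {suc x} {zero}  {zero}      _  _  = refl
  unique′ {suc x} {zero}  {suc z}     e  e′ = contradiction (z , e′) (row-unpartnered e)
  unique′ {suc x} {suc y} {zero}      e  e′ = contradiction (y , e) (row-unpartnered e′)
  unique′ {suc x} {suc y} {suc z}     e  e′ = cong suc (partner-unique e e′)

unmatched : ∀ {n} → Bool → Sided n → Sided (suc n)
unmatched b X = extend b (sideDist b ∘ side X) X

-- New points 0 (side true) and 1 (side false), matched to each other.
pair : ∀ {n} → Sided n → Sided (suc (suc n))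
pair X = extend true (3 ◂ sideDist true ∘ side X) (unmatched false X)

unmatched-splitSpace : ∀ {n} {X : Sided n} b → SplitSpace X → SplitSpace (unmatched b X)
unmatched-splitSpace {X = X} b S = extend-splitSpace S record
  { row-same        = λ s≡b → sideDist-≡ (sym s≡b)
  ; row-other       = λ s≢b → inj₁ (sideDist-≢ (s≢b ∘ sym))
  ; row-unique      = λ {y} e → contradiction e (sideDist≢3 b (side X y))
  ; row-unpartnered = λ {y} e → contradiction e (sideDist≢3 b (side X y))
  }

pair-splitSpace : ∀ {n} {X : Sided n} → SplitSpace X → SplitSpace (pair X)
pair-splitSpace {n} {X} S = extend-splitSpace (unmatched-splitSpace false S) record
  { row-same        = λ {y} → same {y}
  ; row-other       = λ {y} → other {y}
  ; row-unique      = λ {y z} → unique {y} {z}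
  ; row-unpartnered = λ {y} → unpartnered {y}
  }
  where
  row : Fin (suc n) → ℕ
  row = 3 ◂ sideDist true ∘ side X

  same : ∀ {y} → side (unmatched false X) y ≡ true → row y ≡ 2
  same {suc y} s≡t = sideDist-≡ (sym s≡t)

  other : ∀ {y} → side (unmatched false X) y ≢ true → row y ≡ 1 ⊎ row y ≡ 3
  other {zero}  _   = inj₂ refl
  other {suc y} s≢t = inj₁ (sideDist-≢ (s≢t ∘ sym))

  unique : ∀ {y z} → row y ≡ 3 → row z ≡ 3 → y ≡ z
  unique {zero}  {zero}  _ _ = refl
  unique {zero}  {suc z} _ e = contradiction e (sideDist≢3 true (side X z))
  unique {suc y}         e _ = contradiction e (sideDist≢3 true (side X y))

  unpartnered : ∀ {y} → row y ≡ 3 → ¬ HasPartner (dist (unmatched false X)) y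
  unpartnered {zero}  _ (suc z , e) = sideDist≢3 false (side X z) e
  unpartnered {suc y} e _           = sideDist≢3 true (side X y) e

-- Junk unless n = c + b + 2a.
canon : (a b c n : ℕ) → Sided n
canon a       b       (suc c) (suc n)       = unmatched false (canon a b c n)
canon a       (suc b) zero    (suc n)       = unmatched true (canon a b zero n)
canon (suc a) zero    zero    (suc (suc n)) = pair (canon a zero zero n)
canon _       _       _       _             = ⟨ (λ _ _ → 0) , (λ _ → false) ⟩

canon-splitSpace : ∀ a b c n → c + b + (a + a) ≡ n → SplitSpace (canon a b c n)
canon-splitSpace a       b       (suc c) (suc n) eq =
  unmatched-splitSpace false (canon-splitSpace a b c n (suc-injective eq))
canon-splitSpace a       (suc b) zero    (suc n) eq =
  unmatched-splitSpace true (canon-splitSpace a b zero n (suc-injective eq))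
canon-splitSpace zero    zero    zero    .zero   refl = record
  { dist-refl = λ () ; dist-sym = λ () ; same-side = λ { {()} } ; other-side = λ { {()} }
  ; partner-unique = λ { {()} } }
canon-splitSpace (suc a) zero    zero    ._      refl rewrite +-suc a a =
  pair-splitSpace (canon-splitSpace a zero zero (a + a) refl)

-- Classification up to isomorphism

restrict : ∀ {n} → Fin (suc n) → Sided (suc n) → Sided n
restrict p X = ⟨ (λ x y → dist X (punchIn p x) (punchIn p y)) , side X ∘ punchIn p ⟩

restrict-splitSpace : ∀ {n} {X : Sided (suc n)} p → SplitSpace X → SplitSpace (restrict p X)
restrict-splitSpace p S = record
  { dist-refl      = λ x → dist-refl (punchIn p x)
  ; dist-sym       = λ x y → dist-sym (punchIn p x) (punchIn p y)
  ; same-side      = λ {x y} x≢y → same-side (x≢y ∘ punchIn-injective p x y)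
  ; other-side     = other-side
  ; partner-unique = λ {x y z} e e′ → punchIn-injective p y z (partner-unique e e′)
  }
  where open SplitSpace S

partner-restrict : ∀ {n} {X : Sided (suc n)} {p x} →
  HasPartner (dist X) (punchIn p x) → dist X (punchIn p x) p ≢ 3 → HasPartner (dist (restrict p X)) x
partner-restrict {X = X} {p} {x} (y , e) ≢3 with p ≟ᶠ y
... | yes refl = contradiction e ≢3
... | no p≢y   = punchOut p≢y , subst (λ z → dist X (punchIn p x) z ≡ 3) (sym (punchIn-punchOut p≢y)) e

record _≅_ {n} (X Y : Sided n) : Set where
  field
    perm            : Permutation n n
    dist-preserving : ∀ x y → dist Y (perm ⟨$⟩ʳ x) (perm ⟨$⟩ʳ y) ≡ dist X x y
    side-preserving : ∀ x → side Y (perm ⟨$⟩ʳ x) ≡ side X x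

isometric : ∀ {n} {X Y : Sided n} → X ≅ Y → Isometric (dist X) (dist Y)
isometric i = perm , dist-preserving
  where open _≅_ i

data PunchView {n} (p : Fin (suc n)) : Fin (suc n) → Set where
  at      : PunchView p p
  punched : ∀ x → PunchView p (punchIn p x)

punchView : ∀ {n} (p x : Fin (suc n)) → PunchView p x
punchView p x with p ≟ᶠ x
... | yes refl = at
... | no p≢x   = subst (PunchView p) (punchIn-punchOut p≢x) (punched (punchOut p≢x))

insert-at : ∀ {m n} (i : Fin (suc m)) (j : Fin (suc n)) (π : Permutation m n) → insert i j π ⟨$⟩ʳ i ≡ j
insert-at i j π with i ≟ᶠ i
... | yes _  = refl
... | no i≢i = contradiction refl i≢i

extend-≅ : ∀ {n} {X : Sided (suc n)} {Y : Sided n} {p b} →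
  (∀ x → dist X x x ≡ 0) → (∀ x y → dist X x y ≡ dist X y x) → side X p ≡ b →
  (i : restrict p X ≅ Y) (row : Fin n → ℕ) →
  (∀ x → row (_≅_.perm i ⟨$⟩ʳ x) ≡ dist X p (punchIn p x)) →
  X ≅ extend b row Y
extend-≅ {n} {X} {Y} {p} {b} dist-refl dist-sym sp i row rowX = record
  { perm = ρ ; dist-preserving = preserving ; side-preserving = side-preserving′ }
  where
  open _≅_ i
  ρ : Permutation (suc n) (suc n)
  ρ = insert p zero perm
  D : Dist (suc n)
  D = extendDist row (dist Y)

  ρ-punchIn : ∀ x → ρ ⟨$⟩ʳ punchIn p x ≡ suc (perm ⟨$⟩ʳ x)
  ρ-punchIn = Perm.insert-punchIn p zero perm

  preserving : ∀ x y → D (ρ ⟨$⟩ʳ x) (ρ ⟨$⟩ʳ y) ≡ dist X x y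
  preserving x y with punchView p x | punchView p y
  ... | at        | at        =
        trans (cong₂ D (insert-at p zero perm) (insert-at p zero perm)) (sym (dist-refl p))
  ... | at        | punched y = trans (cong₂ D (insert-at p zero perm) (ρ-punchIn y)) (rowX y)
  ... | punched x | at        =
        trans (cong₂ D (ρ-punchIn x) (insert-at p zero perm)) (trans (rowX x) (dist-sym p (punchIn p x)))
  ... | punched x | punched y = trans (cong₂ D (ρ-punchIn x) (ρ-punchIn y)) (dist-preserving x y)

  side-preserving′ : ∀ x → (b ◂ side Y) (ρ ⟨$⟩ʳ x) ≡ side X x
  side-preserving′ x with punchView p x
  ... | at        = trans (cong (b ◂ side Y) (insert-at p zero perm)) (sym sp)
  ... | punched x = trans (cong (b ◂ side Y) (ρ-punchIn x)) (side-preserving x)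

insert-unmatched : ∀ {n} {X : Sided (suc n)} {Y : Sided n} {p b} → SplitSpace X →
  side X p ≡ b → ¬ HasPartner (dist X) p → restrict p X ≅ Y → X ≅ unmatched b Y
insert-unmatched {X = X} {Y} {p} {b} S sp lone i = extend-≅ dist-refl dist-sym sp i _ λ x → begin
  sideDist b (side Y (perm ⟨$⟩ʳ x))          ≡⟨ cong₂ sideDist (sym sp) (side-preserving x) ⟩
  sideDist (side X p) (side X (punchIn p x)) ≡⟨ dist-nonpartner (punchInᵢ≢i p x ∘ sym) (lone ∘ (_ ,_)) ⟨
  dist X p (punchIn p x)                     ∎
  where
  open SplitSpace S
  open SplitSpaceProperties S
  open _≅_ i
  open ≡-Reasoning

insert-pair : ∀ {n} {X : Sided (suc (suc n))} {Y : Sided n} {p q} → SplitSpace X →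
  side X p ≡ true → dist X p (punchIn p q) ≡ 3 → restrict q (restrict p X) ≅ Y → X ≅ pair Y
insert-pair {n} {X} {Y} {p} {q} S sp pq i = extend-≅ dist-refl dist-sym sp i′ row row-matches
  where
  open SplitSpace S
  open SplitSpaceProperties S
  open _≅_ i
  open ≡-Reasoning
  row : Fin (suc n) → ℕ
  row = 3 ◂ sideDist true ∘ side Y
  q̂ : Fin (suc (suc n))
  q̂ = punchIn p q

  q-false : side X q̂ ≡ false
  q-false = trans (¬-not (partner-side pq ∘ sym)) (cong not sp)

  -- q̂ is p's partner, so it is lone once p is removed.
  q-lone : ¬ HasPartner (dist (restrict p X)) q
  q-lone (z , e) = punchInᵢ≢i p z (sym (partner-unique (trans (dist-sym q̂ p) pq) e))

  i′ : restrict p X ≅ unmatched false Y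
  i′ = insert-unmatched (restrict-splitSpace p S) q-false q-lone i

  -- The permutation of i′ is insert q zero perm, by definition of extend-≅.
  row-matches : ∀ x → row (_≅_.perm i′ ⟨$⟩ʳ x) ≡ dist X p (punchIn p x)
  row-matches x with punchView q x
  ... | at        = trans (cong row (insert-at q zero perm)) (sym pq)
  ... | punched z = begin
    row (insert q zero perm ⟨$⟩ʳ punchIn q z) ≡⟨ cong row (Perm.insert-punchIn q zero perm z) ⟩
    sideDist true (side Y (perm ⟨$⟩ʳ z))     ≡⟨ cong₂ sideDist (sym sp) (side-preserving z) ⟩
    sideDist (side X p) (side X w)          ≡⟨ dist-nonpartner (punchInᵢ≢i p _ ∘ sym) w-not-partner ⟨
    dist X p w                              ∎
    where
    w : Fin (suc (suc n))
    w = punchIn p (punchIn q z)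
    w-not-partner : dist X p w ≢ 3
    w-not-partner e = punchInᵢ≢i q z (sym (punchIn-injective p _ _ (partner-unique pq e)))

≅-empty : (X Y : Sided 0) → X ≅ Y
≅-empty X Y = record { perm = Perm.id ; dist-preserving = λ () ; side-preserving = λ () }

Partnered : ∀ {n} → Bool → Sided n → Set
Partnered b X = ∀ x → side X x ≡ b → HasPartner (dist X) x

partner-as-punchIn : ∀ {n} {X : Sided (suc n)} {x y} → SplitSpace X → dist X x y ≡ 3 →
  ∃[ q ] dist X x (punchIn x q) ≡ 3
partner-as-punchIn {X = X} {x} {y} S e =
  punchOut x≢y , subst (λ z → dist X x z ≡ 3) (sym (punchIn-punchOut x≢y)) e
  where
  x≢y : x ≢ y
  x≢y = SplitSpaceProperties.partner-≢ S e

oriented-partners : ∀ {n} {X : Sided (suc n)} {x y} → SplitSpace X → dist X x y ≡ 3 →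
  ∃[ p ] ∃[ q ] side X p ≡ true × dist X p (punchIn p q) ≡ 3
oriented-partners {X = X} {x} {y} S e with side X x in sx
... | true  = x , map₂ (sx ,_) (partner-as-punchIn S e)
... | false = y , map₂ (y-true ,_) (partner-as-punchIn S (trans (SplitSpace.dist-sym S y x) e))
  where
  y-true : side X y ≡ true
  y-true = trans (¬-not (SplitSpaceProperties.partner-side S e ∘ sym)) (cong not sx)

classify-perfect : ∀ {n} {X : Sided n} → SplitSpace X → (∀ x → HasPartner (dist X) x) →
  ∃[ a ] a + a ≡ n × X ≅ canon a 0 0 n
classify-perfect {zero} S _ = 0 , refl , ≅-empty _ _
classify-perfect {suc zero} S matched with matched zero
... | zero , e = contradiction refl (SplitSpaceProperties.partner-≢ S e)
classify-perfect {suc (suc n)} {X} S matched with oriented-partners S (proj₂ (matched zero))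
... | p , q , sp , pq with classify-perfect (restrict-splitSpace q (restrict-splitSpace p S)) rest-matched
  where
  open SplitSpace S
  rest-matched : ∀ z → HasPartner (dist (restrict q (restrict p X))) z
  rest-matched z =
    partner-restrict {X = restrict p X} (partner-restrict {X = X} (matched w) not-p) not-q
    where
    w : Fin (suc (suc n))
    w = punchIn p (punchIn q z)
    not-p : dist X w p ≢ 3
    not-p e =
      punchInᵢ≢i q z (sym (punchIn-injective p _ _ (partner-unique pq (trans (dist-sym p w) e))))
    not-q : dist X w (punchIn p q) ≢ 3
    not-q e = punchInᵢ≢i p _ (SplitSpaceProperties.partner-uniqueˡ S e pq)
...   | a , size , i = suc a , cong suc (trans (+-suc a a) (cong suc size)) , insert-pair S sp pq i

classify-partnered : ∀ {n} {X : Sided n} → SplitSpace X → Partnered false X →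
  ∃[ a ] ∃[ b ] b + (a + a) ≡ n × X ≅ canon a b 0 n
classify-partnered {zero} S _ = 0 , 0 , refl , ≅-empty _ _
classify-partnered {suc n} {X} S partnered with any? (λ p → ¬? (hasPartner? (dist X) p))
... | yes (p , lone) with classify-partnered (restrict-splitSpace p S) rest-partnered
  where
  rest-partnered : Partnered false (restrict p X)
  rest-partnered x sx =
    partner-restrict {X = X} (partnered _ sx) (lone ∘ (_ ,_) ∘ trans (SplitSpace.dist-sym S p _))
...   | a , b , size , i =
      a , suc b , cong suc size , insert-unmatched S (¬-not (lone ∘ partnered p)) lone i
classify-partnered {suc n} {X} S partnered | no none = map₂ (0 ,_) (classify-perfect S matched)
  where
  matched : ∀ x → HasPartner (dist X) x
  matched x = decidable-stable (hasPartner? (dist X) x) (none ∘ (x ,_))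

-- Lone points of side false are removed first, then those of side true, then pairs:
-- the order in which canon builds the space.
classify : ∀ {n} {X : Sided n} → SplitSpace X →
  ∃[ a ] ∃[ b ] ∃[ c ] c + b + (a + a) ≡ n × X ≅ canon a b c n
classify {zero} S = 0 , 0 , 0 , refl , ≅-empty _ _
classify {suc n} {X} S with any? (λ p → (side X p ≟ᵇ false) ×-dec ¬? (hasPartner? (dist X) p))
... | yes (p , sp , lone) with classify (restrict-splitSpace p S)
...   | a , b , c , size , i = a , b , suc c , cong suc size , insert-unmatched S sp lone i
classify {suc n} {X} S | no none = map₂ (map₂ (0 ,_)) (classify-partnered S partnered)
  where
  partnered : Partnered false X
  partnered x sx = decidable-stable (hasPartner? (dist X) x) (none ∘ (x ,_) ∘ (sx ,_))

-- Isometry invariants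

indicator : Bool → ℕ
indicator b = if b then 1 else 0

count : ∀ {n} → (Fin n → Bool) → ℕ
count f = sum (indicator ∘ f)

count-cong : ∀ {n} {f g : Fin n → Bool} → f ≗ g → count f ≡ count g
count-cong f≗g = sum-cong-≗ (cong indicator ∘ f≗g)

count-permute : ∀ {n} (π : Permutation n n) f → count (f ∘ (π ⟨$⟩ʳ_)) ≡ count f
count-permute π f = sym (sum-permute (indicator ∘ f) π)

∣∣≡count : ∀ {n} (Q : Subset n) → ∣ Q ∣ ≡ count (lookup Q)
∣∣≡count []          = refl
∣∣≡count (true ∷ Q)  = cong suc (∣∣≡count Q)
∣∣≡count (false ∷ Q) = ∣∣≡count Q

sideCount-≅ : ∀ {n} {X Y : Sided n} → X ≅ Y → count (side X) ≡ count (side Y)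
sideCount-≅ {Y = Y} i = trans (count-cong (sym ∘ side-preserving)) (count-permute perm (side Y))
  where open _≅_ i

partnerCount : ∀ {n} → Dist n → ℕ
partnerCount d = count (λ x → does (hasPartner? d x))

partnerCount-isometric : ∀ {n} {d e : Dist n} → Isometric d e → partnerCount d ≡ partnerCount e
partnerCount-isometric {d = d} {e} (π , preserving) =
  trans (count-cong (λ x → does-⇔ (transport x) (hasPartner? d x) (hasPartner? e (π ⟨$⟩ʳ x))))
        (count-permute π _)
  where
  transport : ∀ x → HasPartner d x ⇔ HasPartner e (π ⟨$⟩ʳ x)
  transport x = mk⇔
    (λ (y , d≡3) → π ⟨$⟩ʳ y , trans (preserving x y) d≡3)
    (λ (y , e≡3) → π ⟨$⟩ˡ y ,
      trans (sym (preserving x _)) (trans (cong (e (π ⟨$⟩ʳ x)) (inverseʳ π)) e≡3))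

partner-extend-zero : ∀ {n} {row : Fin n → ℕ} {d} → (∀ y → row y ≢ 3) → ¬ HasPartner (extendDist row d) zero
partner-extend-zero row≢3 (suc y , e) = row≢3 y e

partner-extend-suc : ∀ {n} {row : Fin n → ℕ} {d x} → row x ≢ 3 →
  HasPartner (extendDist row d) (suc x) ⇔ HasPartner d x
partner-extend-suc row≢3 = mk⇔
  (λ { (zero , e) → contradiction e row≢3 ; (suc y , e) → y , e })
  (λ (y , e) → suc y , e)

partnerCount-unmatched : ∀ {n} b (X : Sided n) → partnerCount (dist (unmatched b X)) ≡ partnerCount (dist X)
partnerCount-unmatched {n} b X = cong₂ _+_
  (cong indicator (dec-false (hasPartner? D zero) (partner-extend-zero (sideDist≢3 b ∘ side X))))
  (count-cong λ x → does-⇔ (partner-extend-suc (sideDist≢3 b (side X x)))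
                             (hasPartner? D (suc x)) (hasPartner? (dist X) x))
  where
  D : Dist (suc n)
  D = dist (unmatched b X)

partnerCount-pair : ∀ {n} (X : Sided n) → partnerCount (dist (pair X)) ≡ 2 + partnerCount (dist X)
partnerCount-pair {n} X = cong₂ _+_
  (cong indicator (dec-true (hasPartner? D zero) (suc zero , refl)))
  (cong₂ _+_ (cong indicator (dec-true (hasPartner? D (suc zero)) (zero , refl))) (count-cong λ x →
    trans (does-⇔ (partner-extend-suc (sideDist≢3 true (side X x)))
                  (hasPartner? D (suc (suc x))) (hasPartner? D′ (suc x)))
          (does-⇔ (partner-extend-suc (sideDist≢3 false (side X x)))
                  (hasPartner? D′ (suc x)) (hasPartner? (dist X) x))))
  where
  D : Dist (suc (suc n))
  D = dist (pair X)
  D′ : Dist (suc n)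
  D′ = dist (unmatched false X)

canon-sideCount : ∀ a b c n → c + b + (a + a) ≡ n → count (side (canon a b c n)) ≡ b + a
canon-sideCount a       b       (suc c) (suc n) eq = canon-sideCount a b c n (suc-injective eq)
canon-sideCount a       (suc b) zero    (suc n) eq =
  cong suc (canon-sideCount a b zero n (suc-injective eq))
canon-sideCount zero    zero    zero    .zero   refl = refl
canon-sideCount (suc a) zero    zero    ._      refl rewrite +-suc a a =
  cong suc (canon-sideCount a zero zero (a + a) refl)

canon-partnerCount : ∀ a b c n → c + b + (a + a) ≡ n → partnerCount (dist (canon a b c n)) ≡ a + a
canon-partnerCount a       b       (suc c) (suc n) eq =
  trans (partnerCount-unmatched false (canon a b c n)) (canon-partnerCount a b c n (suc-injective eq))
canon-partnerCount a       (suc b) zero    (suc n) eq =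
  trans (partnerCount-unmatched true (canon a b zero n)) (canon-partnerCount a b zero n (suc-injective eq))
canon-partnerCount zero    zero    zero    .zero   refl = refl
canon-partnerCount (suc a) zero    zero    ._      refl rewrite +-suc a a =
  trans (partnerCount-pair (canon a zero zero (a + a)))
        (cong (2 +_) (canon-partnerCount a zero zero (a + a) refl))

-- Split spaces are the spaces of the class with a 2-clique split

data CrossPair : ℕ → ℕ → Set where
  one-one   : CrossPair 1 1
  one-three : CrossPair 1 3
  three-one : CrossPair 3 1

crossPair : ∀ {b c} → b ≡ 1 ⊎ b ≡ 3 → c ≡ 1 ⊎ c ≡ 3 → (b ≡ 3 → c ≡ 3 → ⊥) → CrossPair b c
crossPair (inj₁ refl) (inj₁ refl) _ = one-one
crossPair (inj₁ refl) (inj₂ refl) _ = one-three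
crossPair (inj₂ refl) (inj₁ refl) _ = three-one
crossPair (inj₂ refl) (inj₂ refl) not-both = ⊥-elim (not-both refl refl)

-- The distances (xy, yz, xz) of three distinct points: the apex is the point alone on its side.
data TriangleShape : ℕ → ℕ → ℕ → Set where
  equilateral : TriangleShape 2 2 2
  apex-z      : ∀ {b c} → CrossPair b c → TriangleShape 2 b c
  apex-x      : ∀ {a c} → CrossPair a c → TriangleShape a 2 c
  apex-y      : ∀ {a b} → CrossPair a b → TriangleShape a b 2

swap₁₂ : ∀ {x y z : ℕ} → x ∷ y ∷ z ∷ [] ↭ y ∷ x ∷ z ∷ []
swap₁₂ = swap _ _ ↭-refl

swap₂₃ : ∀ {x y z : ℕ} → x ∷ y ∷ z ∷ [] ↭ x ∷ z ∷ y ∷ []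
swap₂₃ = prep _ (swap _ _ ↭-refl)

shape⇒allowed : ∀ {a b c} → TriangleShape a b c → AllowedTriangle a b c
shape⇒allowed equilateral         = inj₂ (inj₂ ↭-refl)
shape⇒allowed (apex-z one-one)    = inj₁ (↭-trans swap₁₂ swap₂₃)
shape⇒allowed (apex-z one-three)  = inj₂ (inj₁ swap₁₂)
shape⇒allowed (apex-z three-one)  = inj₂ (inj₁ (↭-trans swap₂₃ swap₁₂))
shape⇒allowed (apex-x one-one)    = inj₁ swap₂₃
shape⇒allowed (apex-x one-three)  = inj₂ (inj₁ ↭-refl)
shape⇒allowed (apex-x three-one)  = inj₂ (inj₁ (↭-trans swap₁₂ (↭-trans swap₂₃ swap₁₂)))
shape⇒allowed (apex-y one-one)    = inj₁ ↭-refl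
shape⇒allowed (apex-y one-three)  = inj₂ (inj₁ swap₂₃)
shape⇒allowed (apex-y three-one)  = inj₂ (inj₁ (↭-trans swap₁₂ swap₂₃))

shape⇒triangle : ∀ {a b c} → TriangleShape a b c → c ≤ a + b
shape⇒triangle equilateral        = ≤ᵇ⇒≤ _ _ _
shape⇒triangle (apex-z one-one)   = ≤ᵇ⇒≤ _ _ _
shape⇒triangle (apex-z one-three) = ≤ᵇ⇒≤ _ _ _
shape⇒triangle (apex-z three-one) = ≤ᵇ⇒≤ _ _ _
shape⇒triangle (apex-x one-one)   = ≤ᵇ⇒≤ _ _ _
shape⇒triangle (apex-x one-three) = ≤ᵇ⇒≤ _ _ _
shape⇒triangle (apex-x three-one) = ≤ᵇ⇒≤ _ _ _
shape⇒triangle (apex-y one-one)   = ≤ᵇ⇒≤ _ _ _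
shape⇒triangle (apex-y one-three) = ≤ᵇ⇒≤ _ _ _
shape⇒triangle (apex-y three-one) = ≤ᵇ⇒≤ _ _ _

in123⇒≢0 : ∀ {a} → In123 a → a ≢ 0
in123⇒≢0 (inj₁ refl)        ()
in123⇒≢0 (inj₂ (inj₁ refl)) ()
in123⇒≢0 (inj₂ (inj₂ refl)) ()

module _ {n} {X : Sided n} (S : SplitSpace X) where
  open SplitSpace S
  open SplitSpaceProperties S

  across-≢2 : ∀ {x y} → side X x ≢ side X y → dist X x y ≢ 2
  across-≢2 s≢s with other-side s≢s
  ... | inj₁ d≡1 = λ d≡2 → contradiction (trans (sym d≡1) d≡2) λ ()
  ... | inj₂ d≡3 = λ d≡2 → contradiction (trans (sym d≡3) d≡2) λ ()

  across-nonpartner : ∀ {x y} → side X x ≢ side X y → dist X x y ≢ 3 → dist X x y ≡ 1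
  across-nonpartner s≢s ≢3 with other-side s≢s
  ... | inj₁ d≡1 = d≡1
  ... | inj₂ d≡3 = contradiction d≡3 ≢3

  dist-in123 : ∀ {x y} → x ≢ y → In123 (dist X x y)
  dist-in123 {x} {y} x≢y with side X x ≟ᵇ side X y
  ... | yes s≡s = inj₂ (inj₁ (same-side x≢y s≡s))
  ... | no s≢s with other-side s≢s
  ...   | inj₁ d≡1 = inj₁ d≡1
  ...   | inj₂ d≡3 = inj₂ (inj₂ d≡3)

  triangle-shape : ∀ {x y z} → x ≢ y → y ≢ z → x ≢ z →
    TriangleShape (dist X x y) (dist X y z) (dist X x z)
  triangle-shape {x} {y} {z} x≢y y≢z x≢z with side X x ≟ᵇ side X y | side X y ≟ᵇ side X z
  ... | yes xy | yes yz
    rewrite same-side x≢y xy | same-side y≢z yz | same-side x≢z (trans xy yz) = equilateral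
  ... | yes xy | no yz rewrite same-side x≢y xy = apex-z (crossPair (other-side yz)
    (other-side (yz ∘ trans (sym xy))) λ yz≡3 xz≡3 → x≢y (partner-uniqueˡ xz≡3 yz≡3))
  ... | no xy | yes yz rewrite same-side y≢z yz = apex-x (crossPair (other-side xy)
    (other-side (xy ∘ flip trans (sym yz))) λ xy≡3 xz≡3 → y≢z (partner-unique xy≡3 xz≡3))
  ... | no xy | no yz rewrite same-side x≢z (trans (¬-not xy) (sym (¬-not (yz ∘ sym)))) =
    apex-y (crossPair (other-side xy) (other-side yz)
      λ xy≡3 yz≡3 → x≢z (partner-unique (trans (dist-sym y x) xy≡3) yz≡3))

  splitSpace⇒InA : InA (dist X)
  splitSpace⇒InA = record
    { metric    = record { zero-iff = zero-iff ; refl0 = dist-refl ; sym = dist-sym ; triangle = triangle }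
    ; distances = λ _ _ → dist-in123
    ; triangles = λ _ _ _ x≢y y≢z x≢z → shape⇒allowed (triangle-shape x≢y y≢z x≢z)
    }
    where
    zero-iff : ∀ x y → dist X x y ≡ 0 → x ≡ y
    zero-iff x y d≡0 with x ≟ᶠ y
    ... | yes x≡y = x≡y
    ... | no x≢y  = contradiction d≡0 (in123⇒≢0 (dist-in123 x≢y))

    triangle : ∀ x y z → dist X x z ≤ dist X x y + dist X y z
    triangle x y z with x ≟ᶠ y
    ... | yes refl rewrite dist-refl x = ≤-refl
    ... | no x≢y with y ≟ᶠ z
    ...   | yes refl rewrite dist-refl y = m≤m+n _ 0
    ...   | no y≢z with x ≟ᶠ z
    ...     | yes refl rewrite dist-refl x = z≤n
    ...     | no x≢z = shape⇒triangle (triangle-shape x≢y y≢z x≢z)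

  splitSpace⇒twoCliqueSplit : TwoCliqueSplit (dist X) (count (side X)) (tabulate (side X))
  splitSpace⇒twoCliqueSplit =
      trans (∣∣≡count (tabulate (side X))) (count-cong (lookup∘tabulate (side X)))
    , (λ x y x∈ y∈ x≢y → same-side x≢y (trans (∈⇒true x∈) (sym (∈⇒true y∈))))
    , (λ x y x∈ y∈ x≢y →
         same-side x≢y (trans (∉⇒false (x∈∁p⇒x∉p x∈)) (sym (∉⇒false (x∈∁p⇒x∉p y∈)))))
    , (λ x y x∈ y∉ → across-≢2 λ s≡s →
         contradiction (trans (sym (∈⇒true x∈)) (trans s≡s (∉⇒false y∉))) λ ())
    where
    ∈⇒true : ∀ {x} → x ∈ tabulate (side X) → side X x ≡ true
    ∈⇒true {x} x∈ = trans (sym (lookup∘tabulate (side X) x)) ([]=⇒lookup x∈)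
    ∉⇒false : ∀ {x} → x ∉ tabulate (side X) → side X x ≡ false
    ∉⇒false {x} x∉ = ¬-not (x∉ ∘ lookup⇒[]= x _ ∘ trans (lookup∘tabulate (side X) x))

  across-distances : ∀ x →
      (∀ y → side X y ≢ side X x → dist X x y ≡ 1)
    ⊎ ∃[ y ] side X y ≢ side X x × dist X x y ≡ 3
             × (∀ z → side X z ≢ side X x → z ≢ y → dist X x z ≡ 1)
  across-distances x with hasPartner? (dist X) x
  ... | yes (y , e) = inj₂ (y , partner-side e ∘ sym , e ,
          λ z sz z≢y → across-nonpartner (sz ∘ sym) (z≢y ∘ sym ∘ partner-unique e))
  ... | no lone     = inj₁ λ y sy → across-nonpartner (sy ∘ sym) (lone ∘ (y ,_))

-- {3, b, 3} has product 9b, while the allowed multisets have products 2, 6 and 8.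
no-two-threes : ∀ {b} → In123 b → ¬ AllowedTriangle 3 b 3
no-two-threes (inj₁ refl)        (inj₁ p)        = contradiction (product-↭ p) λ ()
no-two-threes (inj₁ refl)        (inj₂ (inj₁ p)) = contradiction (product-↭ p) λ ()
no-two-threes (inj₁ refl)        (inj₂ (inj₂ p)) = contradiction (product-↭ p) λ ()
no-two-threes (inj₂ (inj₁ refl)) (inj₁ p)        = contradiction (product-↭ p) λ ()
no-two-threes (inj₂ (inj₁ refl)) (inj₂ (inj₁ p)) = contradiction (product-↭ p) λ ()
no-two-threes (inj₂ (inj₁ refl)) (inj₂ (inj₂ p)) = contradiction (product-↭ p) λ ()
no-two-threes (inj₂ (inj₂ refl)) (inj₁ p)        = contradiction (product-↭ p) λ ()
no-two-threes (inj₂ (inj₂ refl)) (inj₂ (inj₁ p)) = contradiction (product-↭ p) λ ()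
no-two-threes (inj₂ (inj₂ refl)) (inj₂ (inj₂ p)) = contradiction (product-↭ p) λ ()

lookup-false⇒∉ : ∀ {n} {Q : Subset n} {x} → lookup Q x ≡ false → x ∉ Q
lookup-false⇒∉ Qx≡false x∈Q = contradiction (trans (sym ([]=⇒lookup x∈Q)) Qx≡false) λ ()

∉⇒lookup≢ : ∀ {n} {Q : Subset n} {x y} → x ∈ Q → y ∉ Q → lookup Q y ≢ lookup Q x
∉⇒lookup≢ {Q = Q} x∈Q y∉Q Qy≡Qx = y∉Q (lookup⇒[]= _ Q (trans Qy≡Qx ([]=⇒lookup x∈Q)))

lookup≢⇒∉ : ∀ {n} {Q : Subset n} {x y} → x ∈ Q → lookup Q y ≢ lookup Q x → y ∉ Q
lookup≢⇒∉ x∈Q Qy≢Qx y∈Q = Qy≢Qx (trans ([]=⇒lookup y∈Q) (sym ([]=⇒lookup x∈Q)))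

splitSpace-of-split : ∀ {n} {d : Dist n} {k Q} →
  InA d → TwoCliqueSplit d k Q → SplitSpace ⟨ d , lookup Q ⟩
splitSpace-of-split {d = d} {Q = Q} A (_ , clique₁ , clique₂ , not-2-across) = record
  { dist-refl      = refl0
  ; dist-sym       = sym′
  ; same-side      = same
  ; other-side     = other
  ; partner-unique = unique
  }
  where
  open IsMetric (InA.metric A) renaming (sym to sym′)
  open InA A using (distances; triangles)

  same : ∀ {x y} → x ≢ y → lookup Q x ≡ lookup Q y → d x y ≡ 2
  same {x} {y} x≢y s≡s with lookup Q x in Qx
  ... | true  = clique₁ x y (lookup⇒[]= x Q Qx) (lookup⇒[]= y Q (sym s≡s)) x≢y
  ... | false =
    clique₂ x y (x∉p⇒x∈∁p (lookup-false⇒∉ Qx)) (x∉p⇒x∈∁p (lookup-false⇒∉ (sym s≡s))) x≢y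

  cross-≢2 : ∀ {x y} → lookup Q x ≢ lookup Q y → d x y ≢ 2
  cross-≢2 {x} {y} s≢s with lookup Q x in Qx | lookup Q y in Qy
  ... | true  | true  = contradiction refl s≢s
  ... | false | false = contradiction refl s≢s
  ... | true  | false = not-2-across x y (lookup⇒[]= x Q Qx) (lookup-false⇒∉ Qy)
  ... | false | true  = not-2-across y x (lookup⇒[]= y Q Qy) (lookup-false⇒∉ Qx) ∘ trans (sym′ y x)

  other : ∀ {x y} → lookup Q x ≢ lookup Q y → d x y ≡ 1 ⊎ d x y ≡ 3
  other {x} {y} s≢s with distances x y (λ { refl → s≢s refl })
  ... | inj₁ d≡1        = inj₁ d≡1
  ... | inj₂ (inj₁ d≡2) = contradiction d≡2 (cross-≢2 s≢s)
  ... | inj₂ (inj₂ d≡3) = inj₂ d≡3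

  partner-≢ : ∀ {x y} → d x y ≡ 3 → x ≢ y
  partner-≢ {x} d≡3 refl = contradiction (trans (sym (refl0 x)) d≡3) λ ()

  unique : ∀ {x y z} → d x y ≡ 3 → d x z ≡ 3 → y ≡ z
  unique {x} {y} {z} xy≡3 xz≡3 with y ≟ᶠ z
  ... | yes y≡z = y≡z
  ... | no y≢z  = contradiction
    (subst₂ (λ u v → AllowedTriangle u (d y z) v) xy≡3 xz≡3
            (triangles x y z (partner-≢ xy≡3) y≢z (partner-≢ xz≡3)))
    (no-two-threes (distances y z y≢z))

split-across-distances : ∀ {n k} {d : Dist n} {Q} → InA d → TwoCliqueSplit d k Q → ∀ x → x ∈ Q →
    (∀ y → y ∉ Q → d x y ≡ 1)
  ⊎ (Σ (Fin n) λ y → y ∉ Q × d x y ≡ 3 × (∀ z → z ∉ Q → z ≢ y → d x z ≡ 1))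
split-across-distances A split x x∈Q with across-distances (splitSpace-of-split A split) x
... | inj₁ all-one             = inj₁ λ y y∉Q → all-one y (∉⇒lookup≢ x∈Q y∉Q)
... | inj₂ (y , Qy≢Qx , e , others) =
      inj₂ (y , lookup≢⇒∉ x∈Q Qy≢Qx , e , λ z z∉Q → others z (∉⇒lookup≢ x∈Q z∉Q))

double-injective : ∀ {a b} → a + a ≡ b + b → a ≡ b
double-injective {zero}  {zero}  _  = refl
double-injective {suc a} {suc b} eq =
  cong suc (double-injective (suc-injective (begin
    suc (a + a) ≡⟨ +-suc a a ⟨
    a + suc a   ≡⟨ suc-injective eq ⟩
    b + suc b   ≡⟨ +-suc b b ⟩
    suc (b + b) ∎)))
  where open ≡-Reasoning

open +-*-Solver using (solve; _:+_; _:=_)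

canon-size : ∀ {n k a} → k ≤ n ∸ k → a ≤ k → n ∸ k ∸ a + (k ∸ a) + (a + a) ≡ n
canon-size {n} {k} {a} k≤n∸k a≤k = begin
  n ∸ k ∸ a + (k ∸ a) + (a + a) ≡⟨ regroup (n ∸ k ∸ a) (k ∸ a) a ⟩
  (n ∸ k ∸ a + a) + (k ∸ a + a) ≡⟨ cong₂ _+_ (m∸n+n≡m (≤-trans a≤k k≤n∸k)) (m∸n+n≡m a≤k) ⟩
  n ∸ k + k                     ≡⟨ m∸n+n≡m (≤-trans k≤n∸k (m∸n≤m n k)) ⟩
  n                             ∎
  where
  open ≡-Reasoning
  regroup : ∀ x y a → x + y + (a + a) ≡ (x + a) + (y + a)
  regroup = solve 3 (λ x y a → x :+ y :+ (a :+ a) := (x :+ a) :+ (y :+ a)) refl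

canon-params : ∀ {n k a b c} → b + a ≡ k → c + b + (a + a) ≡ n → k ∸ a ≡ b × n ∸ k ∸ a ≡ c
canon-params {n} {k} {a} {b} {c} b+a≡k size = trans (cong (_∸ a) (sym b+a≡k)) (m+n∸n≡m b a) , (begin
  n ∸ k ∸ a           ≡⟨ ∸-+-assoc n k a ⟩
  n ∸ (k + a)         ≡⟨ cong (_∸ (k + a)) n≡c+k+a ⟩
  c + (k + a) ∸ (k + a) ≡⟨ m+n∸n≡m c (k + a) ⟩
  c                   ∎)
  where
  open ≡-Reasoning
  regroup : ∀ c b a → c + b + (a + a) ≡ c + (b + a + a)
  regroup = solve 3 (λ c b a → c :+ b :+ (a :+ a) := c :+ (b :+ a :+ a)) refl
  n≡c+k+a : n ≡ c + (k + a)
  n≡c+k+a = trans (sym size) (trans (regroup c b a) (cong (λ m → c + (m + a)) b+a≡k))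

-- The canonical family

canonical : (n k : ℕ) → Fin (suc k) → Sided n
canonical n k i = canon (toℕ i) (k ∸ toℕ i) (n ∸ k ∸ toℕ i) n

module _ {n k} (k≤n∸k : k ≤ n ∸ k) (i : Fin (suc k)) where
  private
    a : ℕ
    a = toℕ i
    size : n ∸ k ∸ a + (k ∸ a) + (a + a) ≡ n
    size = canon-size {n} {k} {a} k≤n∸k (toℕ≤pred[n] i)

  canonical-splitSpace : SplitSpace (canonical n k i)
  canonical-splitSpace = canon-splitSpace a (k ∸ a) (n ∸ k ∸ a) n size

  canonical-sideCount : count (side (canonical n k i)) ≡ k
  canonical-sideCount =
    trans (canon-sideCount a (k ∸ a) (n ∸ k ∸ a) n size) (m∸n+n≡m (toℕ≤pred[n] i))

  canonical-partnerCount : partnerCount (dist (canonical n k i)) ≡ a + a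
  canonical-partnerCount = canon-partnerCount a (k ∸ a) (n ∸ k ∸ a) n size

  canonical-valid : InA (dist (canonical n k i)) × HasTwoCliqueSplit (dist (canonical n k i)) k
  canonical-valid = splitSpace⇒InA canonical-splitSpace , tabulate (side (canonical n k i)) ,
    subst (λ m → TwoCliqueSplit (dist (canonical n k i)) m (tabulate (side (canonical n k i))))
          canonical-sideCount (splitSpace⇒twoCliqueSplit canonical-splitSpace)

canonical-distinct : ∀ {n k} → k ≤ n ∸ k → ∀ i j →
  Isometric (dist (canonical n k i)) (dist (canonical n k j)) → i ≡ j
canonical-distinct {n} {k} k≤n∸k i j iso = toℕ-injective (double-injective (begin
  toℕ i + toℕ i                          ≡⟨ canonical-partnerCount k≤n∸k i ⟨
  partnerCount (dist (canonical n k i))  ≡⟨ partnerCount-isometric iso ⟩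
  partnerCount (dist (canonical n k j))  ≡⟨ canonical-partnerCount k≤n∸k j ⟩
  toℕ j + toℕ j                          ∎))
  where open ≡-Reasoning

canonical-complete : ∀ {n k} {d : Dist n} {Q} → InA d → TwoCliqueSplit d k Q →
  ∃[ i ] Isometric d (dist (canonical n k i))
canonical-complete {n} {k} {d} {Q} A split with classify (splitSpace-of-split A split)
... | a , b , c , size , i =
  fromℕ< a<1+k , subst (Isometric d ∘ dist) (sym canonical≡canon) (isometric i)
  where
  open ≡-Reasoning
  b+a≡k : b + a ≡ k
  b+a≡k = begin
    b + a                        ≡⟨ canon-sideCount a b c n size ⟨
    count (side (canon a b c n)) ≡⟨ sideCount-≅ i ⟨
    count (lookup Q)             ≡⟨ ∣∣≡count Q ⟨
    ∣ Q ∣                        ≡⟨ proj₁ split ⟩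
    k                            ∎
  a<1+k : a < suc k
  a<1+k = s≤s (subst (a ≤_) b+a≡k (m≤n+m a b))
  params : k ∸ a ≡ b × n ∸ k ∸ a ≡ c
  params = canon-params {n} {k} {a} {b} {c} b+a≡k size
  canonical≡canon : canonical n k (fromℕ< a<1+k) ≡ canon a b c n
  canonical≡canon rewrite toℕ-fromℕ< a<1+k =
    cong₂ (λ b′ c′ → canon a b′ c′ n) (proj₁ params) (proj₂ params)

lemma2p8 : (n k : ℕ) → k ≤ n ∸ k →
    (Σ (Fin (suc k) → Dist n) λ S →
        (∀ i → InA (S i) × HasTwoCliqueSplit (S i) k)
      × (∀ i j → Isometric (S i) (S j) → i ≡ j)
      × (∀ (d : Dist n) → InA d → HasTwoCliqueSplit d k →
           Σ (Fin (suc k)) λ i → Isometric d (S i)))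
    × (∀ (d : Dist n) → InA d → ∀ (Q : Subset n) → TwoCliqueSplit d k Q →
         ∀ x → x ∈ Q →
           (∀ y → y ∉ Q → d x y ≡ 1)
           ⊎ (Σ (Fin n) λ y → y ∉ Q × d x y ≡ 3
                × (∀ z → z ∉ Q → z ≢ y → d x z ≡ 1)))
lemma2p8 n k k≤n∸k =
    ( dist ∘ canonical n k
    , canonical-valid k≤n∸k
    , canonical-distinct k≤n∸k
    , λ d A (Q , split) → canonical-complete A split )
  , λ d A Q split → split-across-distances A split
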